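{- Let $D$ be a $\langle 2,2\rangle$ digraph, $G=CCE(D)$, and let $P_{v,m}=v_1v_2\cdots v_m$ be a path in $G$ for some integer $m\ge 3$. If $v^+_{1,2}=v_t$ for some integer $t\in\{3,\ldots,m\}$, then $v^+_{i,i+1}=v_{t+i-1}$ and $v^-_{t+i-2,\,t+i-1}=v_i$ for each integer $i$ with $1\le i\le m-t+1$.
   Context: All graphs and digraphs are simple (no loops, no multiple arcs). In a digraph $D$, if $(u,x)$ is an arc then $x$ is a prey of $u$ and $u$ is a predator of $x$. The CCE graph $CCE(D)$ of $D$ is the graph on $V(D)$ in which distinct $u,v$ are adjacent iff they have a common prey and a common predator in $D$. A $\langle 2,2\rangle$ digraph is a digraph in which every vertex has indegree at most $2$ and outdegree at most $2$. In this setting, for a path $v_1\cdots v_m$ in $G$ with $m\ge 3$ and $1\le i\le m-1$, the vertices $v_i,v_{i+1}$ have exactly one common prey and exactly one common predator in $D$; these are denoted $v^+_{i,i+1}$ and $v^-_{i,i+1}$ respectively. -}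

module Defs where

open import Data.Nat using (ℕ; _≤_)
open import Data.Fin using (Fin)
open import Data.Bool using (Bool; true; false; T)
open import Data.List using (List; length; filterᵇ)
open import Data.List using () renaming (allFin to allFinL)
open import Data.Product using (_×_; Σ; ∃)
open import Relation.Binary.PropositionalEquality using (_≡_; _≢_)
open import Relation.Nullary using (¬_)

record Digraph (n : ℕ) : Set where
  field
    arc     : Fin n → Fin n → Bool
    loopless : ∀ u → arc u u ≡ false
open Digraph public

-- (u , x) is an arc : x is a prey of u, u is a predator of x
Arc : ∀ {n} → Digraph n → Fin n → Fin n → Set
Arc D u x = T (arc D u x)

outdeg : ∀ {n} → Digraph n → Fin n → ℕ
outdeg {n} D u = length (filterᵇ (λ x → arc D u x) (allFinL n))

indeg : ∀ {n} → Digraph n → Fin n → ℕ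
indeg {n} D x = length (filterᵇ (λ u → arc D u x) (allFinL n))

Is22 : ∀ {n} → Digraph n → Set
Is22 D = ∀ v → (indeg D v ≤ 2) × (outdeg D v ≤ 2)

CommonPrey : ∀ {n} → Digraph n → Fin n → Fin n → Fin n → Set
CommonPrey D u v x = Arc D u x × Arc D v x

CommonPred : ∀ {n} → Digraph n → Fin n → Fin n → Fin n → Set
CommonPred D u v y = Arc D y u × Arc D y v

CCEAdj : ∀ {n} → Digraph n → Fin n → Fin n → Set
CCEAdj D u v = (u ≢ v) × (∃ λ x → CommonPrey D u v x) × (∃ λ y → CommonPred D u v y)

-- x is the (unique) common prey of u and v, i.e. x = v⁺ for the pair u, v
IsTheCommonPrey : ∀ {n} → Digraph n → Fin n → Fin n → Fin n → Set
IsTheCommonPrey D u v x = CommonPrey D u v x × (∀ z → CommonPrey D u v z → z ≡ x)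

-- y is the (unique) common predator of u and v, i.e. y = v⁻ for the pair u, v
IsTheCommonPred : ∀ {n} → Digraph n → Fin n → Fin n → Fin n → Set
IsTheCommonPred D u v y = CommonPred D u v y × (∀ z → CommonPred D u v z → z ≡ y)

-- v₁ v₂ ⋯ vₘ is a path in CCE(D); vertices indexed 1..m by a function ℕ → Fin n
-- (values outside 1..m are irrelevant).
IsCCEPath : ∀ {n} → Digraph n → ℕ → (ℕ → Fin n) → Set
IsCCEPath D m v =
  (∀ i j → 1 ≤ i → i Data.Nat.< j → j ≤ m → v i ≢ v j) ×
  (∀ i → 1 ≤ i → Data.Nat.suc i ≤ m → CCEAdj D (v i) (v (Data.Nat.suc i)))

-- A vertex of a ⟨2,2⟩ digraph has at most two prey and two predators, so once two of them
-- are known every further one is among them. Write r = t + i − 2. The arcs v_i → v_r,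
-- v_i → v_{r+1} and v_{i+1} → v_{r+1} force first v⁻_{r+1,r+2} = v_{i+1} (the other candidate
-- v_i would get three prey) and then v⁺_{i+1,i+2} = v_{r+2} (the other candidate v_{r+1} would
-- get three predators); this carries the claim from i to i + 1. For i = 1 it remains to exclude
-- v⁻_{t−1,t} = v_2, i.e. the crossing v_1, v_2 → v_t, v_2 → v_{t−1}. The same forcing moves a
-- crossing between v_a v_{a+1} and v_b v_{b+1} inwards to v_{a+1} v_{a+2} and v_{b−1} v_b,
-- until the two pairs meet and one of its arcs is a loop.
module Submission where

open import Data.Bool using (T)
open import Data.Empty using (⊥; ⊥-elim)
open import Data.Fin using (Fin)
open import Data.Fin.Properties using () renaming (_≟_ to _≟ᶠ_)
open import Data.List using (List; length; filterᵇ; allFin)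
open import Data.List.Membership.Propositional using (_∈_)
open import Data.List.Membership.Propositional.Properties using (∈-filter⁺; ∈-allFin)
open import Data.List.Relation.Unary.Any using (here; there)
open import Data.Nat using (ℕ; zero; suc; _+_; _∸_; _≤_; _<_; z≤n; s≤s)
open import Data.Nat.Properties
  using (_≟_; ≤-refl; ≤-trans; ≤-pred; <⇒≤; ≤⇒≯; ≤∧≢⇒<; n≤1+n; m≤n⇒m≤1+n; m<m+n;
         +-suc; +-comm; +-assoc; +-monoˡ-≤; m∸n+n≡m; module ≤-Reasoning)
open import Data.Product using (_×_; _,_; proj₁; proj₂; ∃; swap)
open import Data.Sum using (_⊎_; inj₁; inj₂)
open import Function using (_∘_)
open import Relation.Binary.PropositionalEquality using (_≡_; _≢_; refl; subst; ≢-sym)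
open import Relation.Nullary using (¬_; yes; no)
open import Relation.Nullary.Decidable using (T?)

open import Defs

module _ {A : Set} where

  private
    variable
      p q r : A
      xs : List A

  ∈⇒1≤length : p ∈ xs → 1 ≤ length xs
  ∈⇒1≤length (here _)  = s≤s z≤n
  ∈⇒1≤length (there _) = s≤s z≤n

  distinct-∈⇒2≤length : p ≢ q → p ∈ xs → q ∈ xs → 2 ≤ length xs
  distinct-∈⇒2≤length p≢q (here refl) (here refl) = ⊥-elim (p≢q refl)
  distinct-∈⇒2≤length p≢q (here _)    (there q∈)  = s≤s (∈⇒1≤length q∈)
  distinct-∈⇒2≤length p≢q (there p∈)  (here _)    = s≤s (∈⇒1≤length p∈)
  distinct-∈⇒2≤length p≢q (there p∈)  (there q∈)  = m≤n⇒m≤1+n (distinct-∈⇒2≤length p≢q p∈ q∈)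

  distinct-∈⇒3≤length : p ≢ q → p ≢ r → q ≢ r → p ∈ xs → q ∈ xs → r ∈ xs → 3 ≤ length xs
  distinct-∈⇒3≤length p≢q p≢r q≢r (here refl) (here refl) _           = ⊥-elim (p≢q refl)
  distinct-∈⇒3≤length p≢q p≢r q≢r (here refl) (there _)   (here refl) = ⊥-elim (p≢r refl)
  distinct-∈⇒3≤length p≢q p≢r q≢r (here _)    (there q∈)  (there r∈)  = s≤s (distinct-∈⇒2≤length q≢r q∈ r∈)
  distinct-∈⇒3≤length p≢q p≢r q≢r (there _)   (here refl) (here refl) = ⊥-elim (q≢r refl)
  distinct-∈⇒3≤length p≢q p≢r q≢r (there p∈)  (here _)    (there r∈)  = s≤s (distinct-∈⇒2≤length p≢r p∈ r∈)
  distinct-∈⇒3≤length p≢q p≢r q≢r (there p∈)  (there q∈)  (here _)    = s≤s (distinct-∈⇒2≤length p≢q p∈ q∈)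
  distinct-∈⇒3≤length p≢q p≢r q≢r (there p∈)  (there q∈)  (there r∈)  =
    m≤n⇒m≤1+n (distinct-∈⇒3≤length p≢q p≢r q≢r p∈ q∈ r∈)

-- Reversing every arc exchanges prey and predators, indegree and outdegree,
-- and CommonPrey and CommonPred, all definitionally.
reverse : ∀ {n} → Digraph n → Digraph n
reverse D = record { arc = λ u x → arc D x u ; loopless = loopless D }

module _ {n : ℕ} (D : Digraph n) where

  private
    variable
      a b c u w x : Fin n

  ¬Arc-loop : ¬ Arc D u u
  ¬Arc-loop {u} loop = subst T (loopless D u) loop

  no-three-prey : outdeg D u ≤ 2 → a ≢ b → a ≢ c → b ≢ c →
                  Arc D u a → Arc D u b → Arc D u c → ⊥
  no-three-prey {u} out≤2 a≢b a≢c b≢c ua ub uc = ≤⇒≯ out≤2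
    (distinct-∈⇒3≤length a≢b a≢c b≢c (prey ua) (prey ub) (prey uc))
    where
    prey : ∀ {x} → Arc D u x → x ∈ filterᵇ (arc D u) (allFin n)
    prey {x} ux = ∈-filter⁺ (T? ∘ arc D u) (∈-allFin x) ux

  prey-cases : outdeg D u ≤ 2 → a ≢ b → Arc D u a → Arc D u b → Arc D u c → c ≡ a ⊎ c ≡ b
  prey-cases {u} {a} {b} {c} out≤2 a≢b ua ub uc with c ≟ᶠ a | c ≟ᶠ b
  ... | yes c≡a | _       = inj₁ c≡a
  ... | no  _   | yes c≡b = inj₂ c≡b
  ... | no  c≢a | no  c≢b = ⊥-elim (no-three-prey out≤2 a≢b (≢-sym c≢a) (≢-sym c≢b) ua ub uc)

  unique⇒IsTheCommonPrey : ∃ (CommonPrey D u w) → (∀ z → CommonPrey D u w z → z ≡ x) →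
                           IsTheCommonPrey D u w x
  unique⇒IsTheCommonPrey {u} {w} (z , uwz) unique =
    subst (CommonPrey D u w) (unique z uwz) uwz , unique

no-three-predators : ∀ {n} (D : Digraph n) {x a b c : Fin n} → indeg D x ≤ 2 →
                     a ≢ b → a ≢ c → b ≢ c → Arc D a x → Arc D b x → Arc D c x → ⊥
no-three-predators D = no-three-prey (reverse D)

predator-cases : ∀ {n} (D : Digraph n) {x a b c : Fin n} → indeg D x ≤ 2 → a ≢ b →
                 Arc D a x → Arc D b x → Arc D c x → c ≡ a ⊎ c ≡ b
predator-cases D = prey-cases (reverse D)

Is22-reverse : ∀ {n} {D : Digraph n} → Is22 D → Is22 (reverse D)
Is22-reverse is22 = swap ∘ is22

IsCCEPath-reverse : ∀ {n} {D : Digraph n} {m v} → IsCCEPath D m v → IsCCEPath (reverse D) m v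
IsCCEPath-reverse {D = D} {m} {v} (distinct , adjacent) = distinct , reverse-adjacent
  where
  reverse-adjacent : ∀ i → 1 ≤ i → suc i ≤ m → CCEAdj (reverse D) (v i) (v (suc i))
  reverse-adjacent i 1≤i i<m with adjacent i 1≤i i<m
  ... | vᵢ≢vᵢ₊₁ , prey , predator = vᵢ≢vᵢ₊₁ , predator , prey

commonPrey-forced : ∀ {n} {D : Digraph n} {u₁ u₂ u₃ x y z : Fin n} → Is22 D →
                    u₁ ≢ u₂ → u₁ ≢ u₃ → u₂ ≢ u₃ → x ≢ y →
                    Arc D u₂ x → Arc D u₂ y → Arc D u₁ y → CommonPrey D u₂ u₃ z → z ≡ x
commonPrey-forced {D = D} {u₂ = u₂} is22 u₁≢u₂ u₁≢u₃ u₂≢u₃ x≢y u₂x u₂y u₁y (u₂z , u₃z)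
  with prey-cases D (proj₂ (is22 u₂)) x≢y u₂x u₂y u₂z
... | inj₁ z≡x  = z≡x
... | inj₂ refl = ⊥-elim (no-three-predators D (proj₁ (is22 _)) u₁≢u₂ u₁≢u₃ u₂≢u₃ u₁y u₂y u₃z)

module OnPath {n} (D : Digraph n) (is22 : Is22 D) {m} {v : ℕ → Fin n} (path : IsCCEPath D m v) where

  private
    variable
      i : ℕ
      x y : Fin n

  adjacent-distinct : 1 ≤ i → suc i ≤ m → v i ≢ v (suc i)
  adjacent-distinct {i} 1≤i i<m = proj₁ path i (suc i) 1≤i ≤-refl i<m

  skip-distinct : 1 ≤ i → suc (suc i) ≤ m → v i ≢ v (suc (suc i))
  skip-distinct {i} 1≤i i+1<m = proj₁ path i (suc (suc i)) 1≤i (s≤s (n≤1+n i)) i+1<m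

  commonPrey-exists : 1 ≤ i → suc i ≤ m → ∃ (CommonPrey D (v i) (v (suc i)))
  commonPrey-exists {i} 1≤i i<m = proj₁ (proj₂ (proj₂ path i 1≤i i<m))

  forward-prey : 1 ≤ i → suc (suc i) ≤ m → x ≢ y →
                 Arc D (v (suc i)) x → Arc D (v (suc i)) y → Arc D (v i) y →
                 IsTheCommonPrey D (v (suc i)) (v (suc (suc i))) x
  forward-prey 1≤i i+1<m x≢y vᵢ₊₁x vᵢ₊₁y vᵢy =
    unique⇒IsTheCommonPrey D (commonPrey-exists (s≤s z≤n) i+1<m) λ _ →
      commonPrey-forced {D = D} is22 (adjacent-distinct 1≤i (<⇒≤ i+1<m)) (skip-distinct 1≤i i+1<m)
        (adjacent-distinct (s≤s z≤n) i+1<m) x≢y vᵢ₊₁x vᵢ₊₁y vᵢy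

  backward-prey : 1 ≤ i → suc (suc i) ≤ m → x ≢ y →
                  Arc D (v (suc i)) x → Arc D (v (suc i)) y → Arc D (v (suc (suc i))) y →
                  Arc D (v i) x
  backward-prey {i} {x} 1≤i i+1<m x≢y vᵢ₊₁x vᵢ₊₁y vᵢ₊₂y with commonPrey-exists 1≤i (<⇒≤ i+1<m)
  ... | z , vᵢz , vᵢ₊₁z = subst (Arc D (v i)) z≡x vᵢz
    where
    z≡x : z ≡ x
    z≡x = commonPrey-forced {D = D} is22
            (≢-sym (adjacent-distinct (s≤s z≤n) i+1<m)) (≢-sym (skip-distinct 1≤i i+1<m))
            (≢-sym (adjacent-distinct 1≤i (<⇒≤ i+1<m))) x≢y vᵢ₊₁x vᵢ₊₁y vᵢ₊₂y (vᵢ₊₁z , vᵢz)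

module Shifting {n} (D : Digraph n) (is22 : Is22 D) {m} {v : ℕ → Fin n} (path : IsCCEPath D m v) where

  open OnPath D is22 path
  open OnPath (reverse D) (Is22-reverse {D = D} is22) (IsCCEPath-reverse {D = D} path) using ()
    renaming (commonPrey-exists to commonPredator-exists; forward-prey to forward-predator;
              backward-prey to backward-predator)

  private
    variable
      a c d i r : ℕ

  Crossing : ℕ → ℕ → Set
  Crossing a b = Arc D (v a) (v (suc b)) × Arc D (v (suc a)) (v (suc b)) × Arc D (v (suc a)) (v b)

  crossing-step : 1 ≤ a → a ≤ c → suc (suc c) ≤ m → Crossing a (suc c) → Crossing (suc a) c
  crossing-step {a} {c} 1≤a a≤c c+1<m (vₐvc₊₂ , vₐ₊₁vc₊₂ , vₐ₊₁vc₊₁) = vₐ₊₁vc₊₁ , vₐ₊₂vc₊₁ , vₐ₊₂vc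
    where
    a+1<m : suc (suc a) ≤ m
    a+1<m = ≤-trans (s≤s (s≤s a≤c)) c+1<m
    vₐ₊₂vc₊₁ : Arc D (v (suc (suc a))) (v (suc c))
    vₐ₊₂vc₊₁ = proj₂ (proj₁ (forward-prey 1≤a a+1<m (adjacent-distinct (s≤s z≤n) c+1<m)
                                          vₐ₊₁vc₊₁ vₐ₊₁vc₊₂ vₐvc₊₂))
    vₐ₊₂vc : Arc D (v (suc (suc a))) (v c)
    vₐ₊₂vc = backward-predator (≤-trans 1≤a a≤c) c+1<m (≢-sym (adjacent-distinct (s≤s z≤n) a+1<m))
                               vₐ₊₂vc₊₁ vₐ₊₁vc₊₁ vₐ₊₁vc₊₂

  ¬crossing : ∀ {a b} → 1 ≤ a → a ≤ b → suc b ≤ m → ¬ Crossing a b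
  ¬crossing {a} {zero}  1≤a a≤0 _ _ = ≤⇒≯ a≤0 1≤a
  ¬crossing {a} {suc c} 1≤a a≤c+1 c+1<m cross@(_ , vₐ₊₁vc₊₂ , vₐ₊₁vc₊₁) with suc c ≟ a | c ≟ a
  ... | yes refl | _        = ¬Arc-loop D vₐ₊₁vc₊₂
  ... | _        | yes refl = ¬Arc-loop D vₐ₊₁vc₊₁
  ... | no c+1≢a | no c≢a   =
    ¬crossing (s≤s z≤n) a<c (<⇒≤ c+1<m) (crossing-step 1≤a (<⇒≤ a<c) c+1<m cross)
    where
    a<c : a < c
    a<c = ≤∧≢⇒< (≤-pred (≤∧≢⇒< a≤c+1 (≢-sym c+1≢a))) (≢-sym c≢a)

  ShiftedAt : ℕ → ℕ → Set
  ShiftedAt i r = IsTheCommonPrey D (v i) (v (suc i)) (v (suc r))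
                × IsTheCommonPred D (v r) (v (suc r)) (v i)

  shiftedAt-base : suc (suc d) ≤ m → IsTheCommonPrey D (v 1) (v 2) (v (suc (suc d))) →
                   ShiftedAt 1 (suc d)
  shiftedAt-base {d} d+1<m prey@((v₁vd₊₂ , v₂vd₊₂) , _) =
    prey , unique⇒IsTheCommonPrey (reverse D) (commonPredator-exists (s≤s z≤n) d+1<m) unique
    where
    unique : ∀ z → CommonPred D (v (suc d)) (v (suc (suc d))) z → z ≡ v 1
    unique z (zvd₊₁ , zvd₊₂)
      with predator-cases D (proj₁ (is22 _))
             (adjacent-distinct ≤-refl (≤-trans (s≤s (s≤s z≤n)) d+1<m)) v₁vd₊₂ v₂vd₊₂ zvd₊₂
    ... | inj₁ z≡v₁ = z≡v₁
    ... | inj₂ refl = ⊥-elim (¬crossing ≤-refl (s≤s z≤n) d+1<m (v₁vd₊₂ , v₂vd₊₂ , zvd₊₁))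

  shiftedAt-step : 1 ≤ i → i < r → suc (suc r) ≤ m → ShiftedAt i r → ShiftedAt (suc i) (suc r)
  shiftedAt-step {i} {r} 1≤i i<r r+1<m (((vᵢvr₊₁ , vᵢ₊₁vr₊₁) , _) , ((vᵢvr , _) , _)) = prey , predator
    where
    predator : IsTheCommonPred D (v (suc r)) (v (suc (suc r))) (v (suc i))
    predator = forward-predator (≤-trans 1≤i (<⇒≤ i<r)) r+1<m
                 (≢-sym (adjacent-distinct 1≤i (≤-trans i<r (<⇒≤ (<⇒≤ r+1<m))))) vᵢ₊₁vr₊₁ vᵢvr₊₁ vᵢvr
    prey : IsTheCommonPrey D (v (suc i)) (v (suc (suc i))) (v (suc (suc r)))
    prey = forward-prey 1≤i (≤-trans (s≤s i<r) (<⇒≤ r+1<m))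
             (≢-sym (adjacent-distinct (s≤s z≤n) r+1<m)) (proj₂ (proj₁ predator)) vᵢ₊₁vr₊₁ vᵢvr₊₁

  shifted : 1 ≤ d → IsTheCommonPrey D (v 1) (v 2) (v (suc (suc d))) →
            ∀ i → 1 ≤ i → suc (i + d) ≤ m → ShiftedAt i (i + d)
  shifted 1≤d prey (suc zero)    _ d+1<m = shiftedAt-base d+1<m prey
  shifted 1≤d prey (suc (suc i)) _ i+d+2<m =
    shiftedAt-step (s≤s z≤n) (s≤s (m<m+n i 1≤d)) i+d+2<m
      (shifted 1≤d prey (suc i) (s≤s z≤n) (<⇒≤ i+d+2<m))

shifted-index-bound : ∀ {i d m} → i ≤ m ∸ suc (suc d) + 1 → suc (suc d) ≤ m → suc (i + d) ≤ m
shifted-index-bound {i} {d} {m} i≤m∸t+1 t≤m = begin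
  suc (i + d)                   ≡⟨ +-suc i d ⟨
  i + suc d                     ≤⟨ +-monoˡ-≤ (suc d) i≤m∸t+1 ⟩
  m ∸ suc (suc d) + 1 + suc d   ≡⟨ +-assoc (m ∸ suc (suc d)) 1 (suc d) ⟩
  m ∸ suc (suc d) + suc (suc d) ≡⟨ m∸n+n≡m t≤m ⟩
  m                             ∎
  where open ≤-Reasoning

theorem2p5 : ∀ {n} (D : Digraph n) → Is22 D →
    (m : ℕ) → 3 ≤ m → (v : ℕ → Fin n) → IsCCEPath D m v →
    (t : ℕ) → 3 ≤ t → t ≤ m → IsTheCommonPrey D (v 1) (v 2) (v t) →
    ∀ i → 1 ≤ i → i ≤ m ∸ t + 1 →
      IsTheCommonPrey D (v i) (v (suc i)) (v (t + i ∸ 1))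
      × IsTheCommonPred D (v (t + i ∸ 2)) (v (t + i ∸ 1)) (v i)
theorem2p5 D is22 m _ v path (suc (suc d)) (s≤s (s≤s 1≤d)) t≤m prey i 1≤i i≤m∸t+1 =
  subst (ShiftedAt i) (+-comm i d) (shifted 1≤d prey i 1≤i (shifted-index-bound i≤m∸t+1 t≤m))
  where open Shifting D is22 path
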